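{- For every FTP-forest $\langle R,X\rangle$ there is an $\mathbf{S}$-forest $[t]$ such that $K[t]=\langle R,X\rangle$.
   Context: For relations with disjoint domains: $\langle R,X\rangle+\langle S,Y\rangle=\langle R\cup S,X\cup Y\rangle$, $\langle R,X\rangle\cdot\langle S,Y\rangle=\langle R\cup S\cup(X\times Y),X\cup Y\rangle$. $\mathbf{S}$-terms are built from an infinite set of $\mathbf{S}$-variables with binary $+$ and $\cdot$; $[t]$ is the class of $t$ modulo the least congruence making $+$ associative and commutative and $\cdot$ associative. $t$ is diversified if no variable occurs twice. For diversified $t$: $K[x]=\langle\emptyset,\{x\}\rangle$, $K[t+s]=K[t]+K[s]$, $K[t\cdot s]=K[t]\cdot K[s]$. Let $C$ be the least set of classes with $[x]\in C$ for each variable $x$, $[t+s]\in C$ whenever $[t],[s]\in C$, and $[x\cdot t]\in C$ whenever $[t]\in C$ and $x$ is a variable; an $\mathbf{S}$-forest is a diversified element of $C$. An FTP-forest is a strict (irreflexive, transitive) partial order $\langle R,X\rangle$ with $X$ a finite set of $\mathbf{S}$-variables such that for all $x,y,z\in X$, if $(x,z),(y,z)\in R$ then $x=y$ or $(x,y)\in R$ or $(y,x)\in R$. -}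

module Defs where

open import Data.Nat using (ℕ)
open import Data.Product using (_×_; _,_)
open import Data.Sum using (_⊎_)
open import Data.Empty using (⊥)
open import Data.List using (List; []; _∷_; _++_)
open import Data.List.Membership.Propositional using (_∈_)
open import Data.List.Relation.Unary.Unique.Propositional using (Unique)
open import Relation.Nullary using (¬_)
open import Relation.Binary.PropositionalEquality using (_≡_)

-- S-variables are natural numbers (an infinite set).
Var : Set
Var = ℕ

data Term : Set where
  var  : Var → Term
  _⊕_  : Term → Term → Term
  _⊙_  : Term → Term → Term

data _≈ₜ_ : Term → Term → Set where
  ≈-refl  : ∀ {t} → t ≈ₜ t
  ≈-sym   : ∀ {t s} → t ≈ₜ s → s ≈ₜ t
  ≈-trans : ∀ {t s u} → t ≈ₜ s → s ≈ₜ u → t ≈ₜ u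
  ⊕-cong  : ∀ {t t' s s'} → t ≈ₜ t' → s ≈ₜ s' → (t ⊕ s) ≈ₜ (t' ⊕ s')
  ⊙-cong  : ∀ {t t' s s'} → t ≈ₜ t' → s ≈ₜ s' → (t ⊙ s) ≈ₜ (t' ⊙ s')
  ⊕-assoc : ∀ {t s u} → ((t ⊕ s) ⊕ u) ≈ₜ (t ⊕ (s ⊕ u))
  ⊕-comm  : ∀ {t s} → (t ⊕ s) ≈ₜ (s ⊕ t)
  ⊙-assoc : ∀ {t s u} → ((t ⊙ s) ⊙ u) ≈ₜ (t ⊙ (s ⊙ u))

vars : Term → List Var
vars (var x) = x ∷ []
vars (t ⊕ s) = vars t ++ vars s
vars (t ⊙ s) = vars t ++ vars s

Diversified : Term → Set
Diversified t = Unique (vars t)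

-- InC t : the class [t] belongs to the least set C of classes
data InC : Term → Set where
  C-var  : ∀ x → InC (var x)
  C-plus : ∀ {t s} → InC t → InC s → InC (t ⊕ s)
  C-dot  : ∀ x {t} → InC t → InC (var x ⊙ t)
  C-resp : ∀ {t t'} → t ≈ₜ t' → InC t → InC t'

SForest : Term → Set
SForest t = InC t × Diversified t

-- K[t] = ⟨ KRel t , KDom t ⟩  (relation and domain, as predicates)
KDom : Term → Var → Set
KDom (var x) y = y ≡ x
KDom (t ⊕ s) y = KDom t y ⊎ KDom s y
KDom (t ⊙ s) y = KDom t y ⊎ KDom s y

KRel : Term → Var → Var → Set
KRel (var x) a b = ⊥
KRel (t ⊕ s) a b = KRel t a b ⊎ KRel s a b
KRel (t ⊙ s) a b = KRel t a b ⊎ (KRel s a b ⊎ (KDom t a × KDom s b))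

-- FTP-forest ⟨R,X⟩: R a finite relation (list of pairs) on the finite set X (list)
record FTPForest (R : List (Var × Var)) (X : List Var) : Set where
  field
    onX     : ∀ {a b} → (a , b) ∈ R → (a ∈ X × b ∈ X)
    irrefl  : ∀ {a} → ¬ ((a , a) ∈ R)
    trans   : ∀ {a b c} → (a , b) ∈ R → (b , c) ∈ R → (a , c) ∈ R
    forest  : ∀ {x y z} → x ∈ X → y ∈ X → z ∈ X →
              (x , z) ∈ R → (y , z) ∈ R →
              (x ≡ y) ⊎ ((x , y) ∈ R ⊎ (y , x) ∈ R)

module Submission where

-- The forest term is built by peeling off a root.  Let L ⊆ X be finite and
-- non-empty and let m be an R-minimal element of L.  Split the rest of L into
--   U = { y ∈ L ∣ m R y }          (the elements above m) and
--   V = { y ∈ L ∣ y ≠ m, ¬ m R y }  (the elements unrelated to m).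
-- Both lists are strictly shorter than L, so by well-founded recursion they are
-- represented by forests t_U and t_V, and L is represented by m·t_U + t_V.
-- The only place where the forest axiom is needed is to exclude R-edges from V
-- into U: if y ∈ V and y R b with b ∈ U then m and y are both below b, hence
-- comparable, contradicting y ≠ m, ¬ m R y and the minimality of m.
--
-- Since U or V may be empty we work with possibly-empty forests (Maybe Term).

open import Defs
open import Data.Product using (_×_; _,_; ∃-syntax; proj₁; proj₂)
open import Data.Sum using (_⊎_; inj₁; inj₂; [_,_])
open import Data.Empty using (⊥; ⊥-elim)
open import Data.Unit using (⊤; tt)
open import Data.Maybe using (Maybe; nothing; just)
open import Data.Nat using (_<_)
open import Data.Nat.Properties using (_≟_)
open import Data.Nat.Induction using (<-wellFounded)
open import Data.Product.Properties using (≡-dec)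
open import Data.List using (List; []; _∷_; filter; length)
open import Data.List.Membership.Propositional using (_∈_)
open import Data.List.Membership.Propositional.Properties using (∈-filter⁺; ∈-filter⁻; ∈-++⁻)
open import Data.List.Relation.Binary.Subset.Propositional using (_⊆_)
open import Data.List.Relation.Binary.Subset.Propositional.Properties using (filter-⊆)
open import Data.List.Relation.Unary.Any using (here; there)
import Data.List.Relation.Unary.Any as Any
open import Data.List.Relation.Unary.All using ([])
open import Data.List.Relation.Unary.All.Properties using (¬Any⇒All¬)
open import Data.List.Relation.Unary.AllPairs using ([]; _∷_)
open import Data.List.Relation.Unary.Unique.Propositional using (Unique)
import Data.List.Relation.Unary.Unique.Propositional.Properties as Unique
open import Data.List.Properties using (filter-notAll)
open import Function.Base using (id; _∘_; _on_)
open import Function.Bundles using (_⇔_; mk⇔; Equivalence)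
open import Induction.WellFounded using (Acc; acc)
open import Relation.Binary.Construct.On using (wellFounded)
open import Relation.Binary.PropositionalEquality using (_≡_; _≢_; refl; sym)
open import Relation.Nullary using (¬_; Dec; yes; no; ¬?)
open import Relation.Nullary.Decidable using (_⊎-dec_)

open Equivalence using (to; from)

-- A possibly-empty forest: nothing is the empty forest ⟨∅,∅⟩.
Forest? : Set
Forest? = Maybe Term

Dom? : Forest? → Var → Set
Dom? nothing  y = ⊥
Dom? (just t) y = KDom t y

Rel? : Forest? → Var → Var → Set
Rel? nothing  a b = ⊥
Rel? (just t) a b = KRel t a b

vars? : Forest? → List Var
vars? nothing  = []
vars? (just t) = vars t

InC? : Forest? → Set
InC? nothing  = ⊤
InC? (just t) = InC t

_⊕?_ : Forest? → Forest? → Forest?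
nothing ⊕? s       = s
just t  ⊕? nothing = just t
just t  ⊕? just u  = just (t ⊕ u)

_◁_ : Var → Forest? → Term
m ◁ nothing = var m
m ◁ just t  = var m ⊙ t

vars⇒dom : ∀ r {x} → x ∈ vars? r → Dom? r x
vars⇒dom nothing ()
vars⇒dom (just (var x)) (here x≡) = x≡
vars⇒dom (just (t ⊕ s)) p = [ inj₁ ∘ vars⇒dom (just t) , inj₂ ∘ vars⇒dom (just s) ] (∈-++⁻ (vars t) p)
vars⇒dom (just (t ⊙ s)) p = [ inj₁ ∘ vars⇒dom (just t) , inj₂ ∘ vars⇒dom (just s) ] (∈-++⁻ (vars t) p)

dom-⊕? : ∀ r s {y} → Dom? (r ⊕? s) y ⇔ (Dom? r y ⊎ Dom? s y)
dom-⊕? nothing  s        = mk⇔ inj₂ [ ⊥-elim , id ]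
dom-⊕? (just t) nothing  = mk⇔ inj₁ [ id , ⊥-elim ]
dom-⊕? (just t) (just u) = mk⇔ id id

rel-⊕? : ∀ r s {a b} → Rel? (r ⊕? s) a b ⇔ (Rel? r a b ⊎ Rel? s a b)
rel-⊕? nothing  s        = mk⇔ inj₂ [ ⊥-elim , id ]
rel-⊕? (just t) nothing  = mk⇔ inj₁ [ id , ⊥-elim ]
rel-⊕? (just t) (just u) = mk⇔ id id

dom-◁ : ∀ m r {y} → KDom (m ◁ r) y ⇔ (y ≡ m ⊎ Dom? r y)
dom-◁ m nothing  = mk⇔ inj₁ [ id , ⊥-elim ]
dom-◁ m (just t) = mk⇔ id id

rel-◁ : ∀ m r {a b} → KRel (m ◁ r) a b ⇔ (Rel? r a b ⊎ (a ≡ m × Dom? r b))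
rel-◁ m nothing  = mk⇔ ⊥-elim [ ⊥-elim , ⊥-elim ∘ proj₂ ]
rel-◁ m (just t) = mk⇔ [ ⊥-elim , id ] inj₂

inC-⊕? : ∀ r s → InC? r → InC? s → InC? (r ⊕? s)
inC-⊕? nothing  s        _ j = j
inC-⊕? (just t) nothing  i _ = i
inC-⊕? (just t) (just u) i j = C-plus i j

inC-◁ : ∀ m r → InC? r → InC (m ◁ r)
inC-◁ m nothing  _ = C-var m
inC-◁ m (just t) i = C-dot m i

diversified-⊕? : ∀ r s → Unique (vars? r) → Unique (vars? s) →
                 (∀ {y} → Dom? r y → Dom? s y → ⊥) → Unique (vars? (r ⊕? s))
diversified-⊕? nothing  s        _ v _ = v
diversified-⊕? (just t) nothing  u _ _ = u
diversified-⊕? (just t) (just w) u v disjoint =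
  Unique.++⁺ u v (λ (p , q) → disjoint (vars⇒dom (just t) p) (vars⇒dom (just w) q))

diversified-◁ : ∀ m r → ¬ Dom? r m → Unique (vars? r) → Unique (vars (m ◁ r))
diversified-◁ m nothing  _   _ = [] ∷ []
diversified-◁ m (just t) m∉r u = ¬Any⇒All¬ (vars t) (m∉r ∘ vars⇒dom (just t)) ∷ u

module Representation (_≺_ : Var → Var → Set) where

  record Represents (P : Var → Set) (r : Forest?) : Set where
    field
      dom         : ∀ y → Dom? r y ⇔ P y
      rel         : ∀ a b → Rel? r a b ⇔ (a ≺ b × P a × P b)
      diversified : Unique (vars? r)
      inC         : InC? r
  open Represents

  represents-cong : ∀ {P Q r} → (∀ y → P y ⇔ Q y) → Represents P r → Represents Q r
  represents-cong P⇔Q rep = record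
    { dom         = λ y → mk⇔ (to (P⇔Q y) ∘ to (dom rep y)) (from (dom rep y) ∘ from (P⇔Q y))
    ; rel         = λ a b → mk⇔
        (λ k → let (a≺b , Pa , Pb) = to (rel rep a b) k in a≺b , to (P⇔Q a) Pa , to (P⇔Q b) Pb)
        (λ (a≺b , Qa , Qb) → from (rel rep a b) (a≺b , from (P⇔Q a) Qa , from (P⇔Q b) Qb))
    ; diversified = diversified rep
    ; inC         = inC rep
    }

  represents-nothing : ∀ {P} → (∀ y → ¬ P y) → Represents P nothing
  represents-nothing ∅ = record
    { dom         = λ y → mk⇔ ⊥-elim (⊥-elim ∘ ∅ y)
    ; rel         = λ a b → mk⇔ ⊥-elim (⊥-elim ∘ ∅ a ∘ proj₁ ∘ proj₂)
    ; diversified = []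
    ; inC         = tt
    }

  represents-⊕? : ∀ {P Q r s} → Represents P r → Represents Q s →
                  (∀ {y} → P y → Q y → ⊥) →
                  (∀ {a b} → P a → Q b → ¬ a ≺ b) → (∀ {a b} → Q a → P b → ¬ a ≺ b) →
                  Represents (λ y → P y ⊎ Q y) (r ⊕? s)
  represents-⊕? {P} {Q} {r} {s} repP repQ disjoint noEdgePQ noEdgeQP = record
    { dom         = λ y → mk⇔
        ([ inj₁ ∘ to (dom repP y) , inj₂ ∘ to (dom repQ y) ] ∘ to (dom-⊕? r s))
        (from (dom-⊕? r s) ∘ [ inj₁ ∘ from (dom repP y) , inj₂ ∘ from (dom repQ y) ])
    ; rel         = λ a b → mk⇔ (fromSum a b ∘ to (rel-⊕? r s)) (from (rel-⊕? r s) ∘ toSum a b)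
    ; diversified = diversified-⊕? r s (diversified repP) (diversified repQ)
        (λ {y} dr ds → disjoint (to (dom repP y) dr) (to (dom repQ y) ds))
    ; inC         = inC-⊕? r s (inC repP) (inC repQ)
    }
    where
    fromSum : ∀ a b → Rel? r a b ⊎ Rel? s a b → a ≺ b × (P a ⊎ Q a) × (P b ⊎ Q b)
    fromSum a b (inj₁ k) = let (a≺b , Pa , Pb) = to (rel repP a b) k in a≺b , inj₁ Pa , inj₁ Pb
    fromSum a b (inj₂ k) = let (a≺b , Qa , Qb) = to (rel repQ a b) k in a≺b , inj₂ Qa , inj₂ Qb

    toSum : ∀ a b → a ≺ b × (P a ⊎ Q a) × (P b ⊎ Q b) → Rel? r a b ⊎ Rel? s a b
    toSum a b (a≺b , inj₁ Pa , inj₁ Pb) = inj₁ (from (rel repP a b) (a≺b , Pa , Pb))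
    toSum a b (a≺b , inj₁ Pa , inj₂ Qb) = ⊥-elim (noEdgePQ Pa Qb a≺b)
    toSum a b (a≺b , inj₂ Qa , inj₁ Pb) = ⊥-elim (noEdgeQP Qa Pb a≺b)
    toSum a b (a≺b , inj₂ Qa , inj₂ Qb) = inj₂ (from (rel repQ a b) (a≺b , Qa , Qb))

  represents-◁ : (∀ {a} → ¬ a ≺ a) → (∀ {a b c} → a ≺ b → b ≺ c → a ≺ c) →
                 ∀ {P r} m → Represents P r → (∀ {y} → P y → m ≺ y) →
                 Represents (λ y → y ≡ m ⊎ P y) (just (m ◁ r))
  represents-◁ irrefl trans {P} {r} m rep above = record
    { dom         = λ y → mk⇔
        ([ inj₁ , inj₂ ∘ to (dom rep y) ] ∘ to (dom-◁ m r))
        (from (dom-◁ m r) ∘ [ inj₁ , inj₂ ∘ from (dom rep y) ])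
    ; rel         = λ a b → mk⇔ (fromRoot a b ∘ to (rel-◁ m r)) (from (rel-◁ m r) ∘ toRoot a b)
    ; diversified = diversified-◁ m r (λ d → irrefl (above (to (dom rep m) d))) (diversified rep)
    ; inC         = inC-◁ m r (inC rep)
    }
    where
    fromRoot : ∀ a b → Rel? r a b ⊎ (a ≡ m × Dom? r b) →
               a ≺ b × (a ≡ m ⊎ P a) × (b ≡ m ⊎ P b)
    fromRoot a b (inj₁ k) = let (a≺b , Pa , Pb) = to (rel rep a b) k in a≺b , inj₂ Pa , inj₂ Pb
    fromRoot a b (inj₂ (refl , d)) = let Pb = to (dom rep b) d in above Pb , inj₁ refl , inj₂ Pb

    toRoot : ∀ a b → a ≺ b × (a ≡ m ⊎ P a) × (b ≡ m ⊎ P b) → Rel? r a b ⊎ (a ≡ m × Dom? r b)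
    toRoot a b (a≺b , inj₁ refl , inj₁ refl) = ⊥-elim (irrefl a≺b)
    toRoot a b (a≺b , inj₁ refl , inj₂ Pb)   = inj₂ (refl , from (dom rep b) Pb)
    toRoot a b (a≺b , inj₂ Pa   , inj₁ refl) = ⊥-elim (irrefl (trans (above Pa) a≺b))
    toRoot a b (a≺b , inj₂ Pa   , inj₂ Pb)   = inj₁ (from (rel rep a b) (a≺b , Pa , Pb))

module Construction (R : List (Var × Var)) (X : List Var) (F : FTPForest R X) where
  open FTPForest F
  open import Data.List.Membership.DecPropositional (≡-dec _≟_ _≟_) using (_∈?_)

  _≺_ : Var → Var → Set
  a ≺ b = (a , b) ∈ R

  _≺?_ : ∀ a b → Dec (a ≺ b)
  a ≺? b = (a , b) ∈? R

  open Representation _≺_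

  minimal : ∀ a L → ∃[ m ] (m ∈ a ∷ L × (∀ {p} → p ∈ a ∷ L → ¬ p ≺ m))
  minimal a [] = a , here refl , λ { (here refl) → irrefl }
  minimal a (b ∷ L) with minimal b L
  ... | m , m∈ , m-min with a ≺? m
  ...   | yes a≺m = a , here refl , λ { (here refl) → irrefl ; (there p) p≺a → m-min p (trans p≺a a≺m) }
  ...   | no  a⊀m = m , there m∈ , λ { (here refl) → a⊀m ; (there p) → m-min p }

  Unrelated : Var → Var → Set
  Unrelated m y = ¬ (y ≡ m ⊎ m ≺ y)

  above : Var → List Var → List Var
  above m = filter (m ≺?_)

  unrelated? : ∀ m y → Dec (Unrelated m y)
  unrelated? m y = ¬? ((y ≟ m) ⊎-dec (m ≺? y))

  unrelated : Var → List Var → List Var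
  unrelated m = filter (unrelated? m)

  decomposition : ∀ {m L} → m ∈ L → ∀ y → ((y ≡ m ⊎ y ∈ above m L) ⊎ y ∈ unrelated m L) ⇔ y ∈ L
  decomposition {m} {L} m∈L y = mk⇔ join split
    where
    join : (y ≡ m ⊎ y ∈ above m L) ⊎ y ∈ unrelated m L → y ∈ L
    join (inj₁ (inj₁ refl)) = m∈L
    join (inj₁ (inj₂ p))    = proj₁ (∈-filter⁻ (m ≺?_) p)
    join (inj₂ p)           = proj₁ (∈-filter⁻ (unrelated? m) p)

    split : y ∈ L → (y ≡ m ⊎ y ∈ above m L) ⊎ y ∈ unrelated m L
    split y∈L with y ≟ m | m ≺? y
    ... | yes y≡m | _       = inj₁ (inj₁ y≡m)
    ... | no  _   | yes m≺y = inj₁ (inj₂ (∈-filter⁺ (m ≺?_) y∈L m≺y))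
    ... | no  y≢m | no  m⊀y =
      inj₂ (∈-filter⁺ (unrelated? m) y∈L [ y≢m , m⊀y ])

  -- Neither part contains m, so both are strictly shorter than L.
  above-shorter : ∀ {m L} → m ∈ L → length (above m L) < length L
  above-shorter {m} {L} m∈L = filter-notAll (m ≺?_) L (Any.map (λ { refl → irrefl }) m∈L)

  unrelated-shorter : ∀ {m L} → m ∈ L → length (unrelated m L) < length L
  unrelated-shorter {m} {L} m∈L =
    filter-notAll (unrelated? m) L (Any.map (λ { refl ¬m → ¬m (inj₁ refl) }) m∈L)

  represents-split : ∀ {m L rU rV} → L ⊆ X → m ∈ L → (∀ {p} → p ∈ L → ¬ p ≺ m) →
                     Represents (_∈ above m L) rU → Represents (_∈ unrelated m L) rV →
                     Represents (_∈ L) (just (m ◁ rU) ⊕? rV)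
  represents-split {m} {L} L⊆X m∈L m-min repU repV =
    represents-cong (decomposition m∈L)
      (represents-⊕? (represents-◁ irrefl trans m repU (proj₂ ∘ ∈-above)) repV
         disjoint noEdgeDown noEdgeUp)
    where
    ∈-above : ∀ {y} → y ∈ above m L → y ∈ L × m ≺ y
    ∈-above = ∈-filter⁻ (m ≺?_)

    ∈-unrelated : ∀ {y} → y ∈ unrelated m L → y ∈ L × Unrelated m y
    ∈-unrelated = ∈-filter⁻ (unrelated? m)

    disjoint : ∀ {y} → y ≡ m ⊎ y ∈ above m L → y ∈ unrelated m L → ⊥
    disjoint (inj₁ y≡m) q = proj₂ (∈-unrelated q) (inj₁ y≡m)
    disjoint (inj₂ p)   q = proj₂ (∈-unrelated q) (inj₂ (proj₂ (∈-above p)))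

    -- No edge from the tree m · t_U into t_V: it would put the target above m.
    noEdgeDown : ∀ {a b} → a ≡ m ⊎ a ∈ above m L → b ∈ unrelated m L → ¬ a ≺ b
    noEdgeDown (inj₁ refl) q a≺b = proj₂ (∈-unrelated q) (inj₂ a≺b)
    noEdgeDown (inj₂ p)    q a≺b = proj₂ (∈-unrelated q) (inj₂ (trans (proj₂ (∈-above p)) a≺b))

    -- No edge from t_V into the tree m · t_U: by minimality of m and the forest axiom.
    noEdgeUp : ∀ {a b} → a ∈ unrelated m L → b ≡ m ⊎ b ∈ above m L → ¬ a ≺ b
    noEdgeUp q (inj₁ refl) = m-min (proj₁ (∈-unrelated q))
    noEdgeUp {a} {b} q (inj₂ p) a≺b =
      incomparable (forest (L⊆X m∈L) (L⊆X a∈L) (L⊆X (proj₁ (∈-above p))) (proj₂ (∈-above p)) a≺b)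
      where
      a∈L : a ∈ L
      a∈L = proj₁ (∈-unrelated q)

      incomparable : m ≡ a ⊎ (m ≺ a ⊎ a ≺ m) → ⊥
      incomparable (inj₁ m≡a)        = proj₂ (∈-unrelated q) (inj₁ (sym m≡a))
      incomparable (inj₂ (inj₁ m≺a)) = proj₂ (∈-unrelated q) (inj₂ m≺a)
      incomparable (inj₂ (inj₂ a≺m)) = m-min a∈L a≺m

  _Shorter_ : List Var → List Var → Set
  _Shorter_ = _<_ on length

  represent : ∀ L → Acc _Shorter_ L → L ⊆ X → ∃[ r ] Represents (_∈ L) r
  represent [] _ _ = nothing , represents-nothing (λ _ ())
  represent (a ∷ L) (acc shorter) L⊆X =
    let (m , m∈L , m-min) = minimal a L
        (rU , repU) = represent (above m (a ∷ L)) (shorter (above-shorter m∈L))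
                                (L⊆X ∘ filter-⊆ (m ≺?_) (a ∷ L))
        (rV , repV) = represent (unrelated m (a ∷ L)) (shorter (unrelated-shorter m∈L))
                                (L⊆X ∘ filter-⊆ (unrelated? m) (a ∷ L))
    in just (m ◁ rU) ⊕? rV , represents-split L⊆X m∈L m-min repU repV

  representX : ∃[ r ] Represents (_∈ X) r
  representX = represent X (wellFounded length <-wellFounded X) id

some-member : ∀ {L : List Var} → L ≢ [] → ∃[ x ] x ∈ L
some-member {[]}    L≢[] = ⊥-elim (L≢[] refl)
some-member {x ∷ _} _    = x , here refl

proposition5p3 : (R : List (Var × Var)) (X : List Var) → X ≢ [] → FTPForest R X →
    ∃[ t ] (SForest t × ((∀ a b → ((a , b) ∈ R ⇔ KRel t a b)) × (∀ y → (y ∈ X ⇔ KDom t y))))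
proposition5p3 R X X≢[] F = fromRepresentation representX
  where
  open Construction R X F
  open FTPForest F using (onX)
  open Representation _≺_
  open Represents

  -- X is non-empty, so its representing forest is an actual term.
  fromRepresentation : ∃[ r ] Represents (_∈ X) r →
    ∃[ t ] (SForest t × ((∀ a b → ((a , b) ∈ R ⇔ KRel t a b)) × (∀ y → (y ∈ X ⇔ KDom t y))))
  fromRepresentation (nothing , rep) =
    let (x , x∈X) = some-member X≢[] in ⊥-elim (from (dom rep x) x∈X)
  fromRepresentation (just t , rep) =
    t , (inC rep , diversified rep) ,
    (λ a b → mk⇔ (λ a≺b → from (rel rep a b) (a≺b , onX a≺b)) (proj₁ ∘ to (rel rep a b))) ,
    (λ y → mk⇔ (from (dom rep y)) (to (dom rep y)))
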